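{- Let $\mathbf{a}=(a_1,\ldots,a_k)$ be an integer partition with $\Delta(\mathbf{a})=0$. Then on every Hamilton path in $G(\mathbf{a})$ whose two end vertices differ in the first entry, every second vertex of the path belongs to $\Pi(\mathbf{a})^{1,1}$ and every other vertex of the path does not belong to $\Pi(\mathbf{a})^{1,1}$.
   Context: An integer partition is $\mathbf{a}=(a_1,\ldots,a_k)$ with $k\geq 2$ and $a_1\geq\cdots\geq a_k\geq 1$; $n=a_1+\cdots+a_k$, $\Delta(\mathbf{a}):=n-2a_1$. $\Pi(\mathbf{a})$ is the set of strings of length $n$ over $\{1,\ldots,k\}$ with exactly $a_i$ occurrences of symbol $i$, and $\Pi(\mathbf{a})^{1,1}$ the subset of those whose first symbol is $1$. $G(\mathbf{a})$ is the graph on $\Pi(\mathbf{a})$ where two strings are adjacent if one arises from the other by swapping the first entry with an entry at some position $2,\ldots,n$ distinct from the first entry. -}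

module Defs where

open import Data.Nat using (ℕ; zero; suc; _≤_; _+_; _*_; _%_)
open import Data.Integer as ℤ using (ℤ; +_; _-_)
open import Data.Fin as Fin using (Fin; zero; suc; toℕ)
open import Data.Fin.Properties using (_≟_)
open import Data.Vec as Vec using (Vec; lookup; count; _[_]≔_)
open import Data.List as List using (List)
open import Data.List.Relation.Unary.All using (All)
open import Data.List.Relation.Unary.Unique.Propositional using (Unique)
open import Data.List.Relation.Unary.Linked using (Linked)
open import Data.List.Membership.Propositional using (_∈_)
open import Data.Maybe using (just)
open import Data.Product using (Σ; _×_; ∃-syntax)
open import Data.Empty using (⊥)
open import Relation.Nullary using (¬_)
open import Relation.Binary.PropositionalEquality using (_≡_; _≢_)

-- A partition a = (a_1,…,a_k) with k = 2 + m ≥ 2 parts, stored as a vector;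
-- symbol i ∈ {1,…,k} of the paper is represented by  Fin k  (symbol 1 = zero).
-- Weakly decreasing, all parts ≥ 1.
IsPartition : {m : ℕ} → Vec ℕ (suc (suc m)) → Set
IsPartition {m} a =
  ((i j : Fin (suc (suc m))) → i Fin.≤ j → lookup a j ≤ lookup a i)
  × ((i : Fin (suc (suc m))) → 1 ≤ lookup a i)

total : {m : ℕ} → Vec ℕ m → ℕ
total a = Vec.sum a

Δ : {m : ℕ} → Vec ℕ (suc (suc m)) → ℤ
Δ a = + total a - + (2 * Vec.head a)

Str : ℕ → ℕ → Set
Str k n = Vec (Fin k) n

InΠ : {k : ℕ} (a : Vec ℕ k) → Str k (total a) → Set
InΠ {k} a s = (i : Fin k) → count (_≟ i) s ≡ lookup a i

FirstIs1 : {k n : ℕ} → Str (suc k) n → Set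
FirstIs1 {n = zero} s = ⊥
FirstIs1 {n = suc n} s = Vec.head s ≡ zero

InΠ11 : {m : ℕ} (a : Vec ℕ (suc m)) → Str (suc m) (total a) → Set
InΠ11 a s = InΠ a s × FirstIs1 s

swap : {A : Set} {n : ℕ} → Vec A n → Fin n → Fin n → Vec A n
swap s i j = (s [ i ]≔ lookup s j) [ j ]≔ lookup s i

SwapStep : {k n : ℕ} → Str k n → Str k n → Set
SwapStep {n = zero} s t = ⊥
SwapStep {n = suc n} s t =
  ∃[ j ] (j ≢ zero × lookup s j ≢ lookup s zero × t ≡ swap s zero j)

Adj : {k n : ℕ} → Str k n → Str k n → Set
Adj s t = SwapStep s t Data.Sum.⊎ SwapStep t s
  where import Data.Sum

IsHamiltonPath : {k : ℕ} (a : Vec ℕ k) → List (Str k (total a)) → Set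
IsHamiltonPath a p =
  All (InΠ a) p
  × Unique p
  × ((s : Str _ (total a)) → InΠ a s → s ∈ p)
  × Linked Adj p

FirstDiffer : {k n : ℕ} → Str k n → Str k n → Set
FirstDiffer {n = zero} s t = ⊥
FirstDiffer {n = suc n} s t = Vec.head s ≢ Vec.head t

EndsDifferFirst : {k n : ℕ} → List (Str k n) → Set
EndsDifferFirst p =
  ∀ u v → List.head p ≡ just u → List.last p ≡ just v → FirstDiffer u v

{-# OPTIONS --safe #-}
-- Strings starting with 1 are pairwise non-adjacent in G(a), since every step changes the
-- first symbol. When Δ(a) = 0, half of the positions of a string in Π(a) carry a 1, so
-- exchanging the 1-positions with the other positions (keeping the order of the other
-- symbols) is an involution of Π(a) taking strings that do not start with 1 to strings that
-- do. Hence at least half of the vertices of a Hamilton path start with 1. A path on which no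
-- two consecutive vertices start with 1 but at least half of them do must alternate, unless
-- both of its ends start with 1, which the hypothesis on the end vertices excludes.
module Submission where

open import Defs
open import Level using (Level; _⊔_)
open import Data.Nat using (ℕ; zero; suc; _+_; _%_; _≤_; _<_; z≤n; s≤s)
open import Data.Nat.Properties
  using (≤-trans; m≤n⇒m≤1+n; 1+n≰n; m≤m+n; +-suc; +-identityʳ; +-cancelʳ-≡; suc-injective)
open import Data.Integer using (0ℤ)
open import Data.Integer.Properties using (+-injective; i-j≡0⇒i≡j)
open import Data.Fin using (Fin; zero; suc; toℕ)
open import Data.Fin.Properties using (_≟_; injective⇒≤)
open import Data.Vec as Vec using (Vec; []; _∷_; count)
open import Data.List using (List; []; _∷_; length; lookup; filter; head; last)
import Data.List.Relation.Unary.All as All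
open import Data.List.Relation.Unary.AllPairs using (_∷_)
open import Data.List.Relation.Unary.Any using (index)
open import Data.List.Relation.Unary.Any.Properties using (lookup-index)
open import Data.List.Relation.Unary.Linked using (Linked; _∷_)
import Data.List.Relation.Unary.Linked as Linked
open import Data.List.Relation.Unary.Unique.Propositional using (Unique)
open import Data.List.Relation.Unary.Unique.Propositional.Properties using (filter⁺)
open import Data.List.Membership.Propositional using (_∈_)
open import Data.List.Membership.Propositional.Properties using (∈-lookup; ∈-filter⁺; ∈-filter⁻)
open import Data.Maybe using (just)
open import Data.Sum using (_⊎_; inj₁; inj₂)
import Data.Sum as Sum
open import Data.Product using (_×_; _,_; proj₁; proj₂)
import Data.Product as Product
open import Data.Empty using (⊥-elim)
open import Function using (_∘_)
open import Function.Bundles using (_⇔_; mk⇔; Equivalence)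
import Function.Properties.Equivalence as ⇔
open import Relation.Nullary using (¬_; Dec; yes; no; ¬?)
open import Relation.Unary using (Pred; Decidable)
open import Relation.Binary.PropositionalEquality using (_≡_; refl; sym; trans; cong; subst; module ≡-Reasoning)
open ≡-Reasoning

private
  variable
    a b : Level
    A : Set a
    B : Set b

suc%2≡0⇔%2≡1 : ∀ n → (suc n % 2 ≡ 0) ⇔ (n % 2 ≡ 1)
suc%2≡0⇔%2≡1 zero = mk⇔ (λ ()) (λ ())
suc%2≡0⇔%2≡1 (suc zero) = mk⇔ (λ _ → refl) (λ _ → refl)
suc%2≡0⇔%2≡1 (suc (suc n)) = suc%2≡0⇔%2≡1 n

suc%2≡1⇔%2≡0 : ∀ n → (suc n % 2 ≡ 1) ⇔ (n % 2 ≡ 0)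
suc%2≡1⇔%2≡0 zero = mk⇔ (λ _ → refl) (λ _ → refl)
suc%2≡1⇔%2≡0 (suc zero) = mk⇔ (λ ()) (λ ())
suc%2≡1⇔%2≡0 (suc (suc n)) = suc%2≡1⇔%2≡0 n

unique⇒lookup-injective : ∀ {xs : List A} → Unique xs → ∀ {i j} → lookup xs i ≡ lookup xs j → i ≡ j
unique⇒lookup-injective (_ ∷ _) {zero} {zero} _ = refl
unique⇒lookup-injective (x∉ ∷ _) {zero} {suc j} eq = ⊥-elim (All.lookup x∉ (∈-lookup j) eq)
unique⇒lookup-injective (x∉ ∷ _) {suc i} {zero} eq = ⊥-elim (All.lookup x∉ (∈-lookup i) (sym eq))
unique⇒lookup-injective (_ ∷ u) {suc i} {suc j} eq = cong suc (unique⇒lookup-injective u eq)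

injectiveOn⇒length≤ : ∀ {xs : List A} {ys : List B} → Unique xs → (f : A → B) →
                      (∀ {x} → x ∈ xs → f x ∈ ys) →
                      (∀ {x y} → x ∈ xs → y ∈ xs → f x ≡ f y → x ≡ y) →
                      length xs ≤ length ys
injectiveOn⇒length≤ {xs = xs} {ys} u f f∈ f-inj = injective⇒≤ position-injective
  where
  position : Fin (length xs) → Fin (length ys)
  position i = index (f∈ (∈-lookup i))

  position-injective : ∀ {i j} → position i ≡ position j → i ≡ j
  position-injective {i} {j} eq = unique⇒lookup-injective u (f-inj (∈-lookup i) (∈-lookup j) (begin
    f (lookup xs i)       ≡⟨ lookup-index (f∈ (∈-lookup i)) ⟩
    lookup ys (position i) ≡⟨ cong (lookup ys) eq ⟩
    lookup ys (position j) ≡⟨ lookup-index (f∈ (∈-lookup j)) ⟨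
    f (lookup xs j)       ∎))

module Alternation {a p} {A : Set a} {P : Pred A p} (P? : Decidable P) where

  Independent : List A → Set _
  Independent = Linked (λ x y → ¬ (P x × P y))

  #P #¬P : List A → ℕ
  #P xs = length (filter P? xs)
  #¬P xs = length (filter (¬? ∘ P?) xs)

  data AltIn : List A → Set (a ⊔ p)
  data AltOut : List A → Set (a ⊔ p)

  data AltIn where
    [] : AltIn []
    _∷_ : ∀ {x xs} → P x → AltOut xs → AltIn (x ∷ xs)

  data AltOut where
    [] : AltOut []
    _∷_ : ∀ {x xs} → ¬ P x → AltIn xs → AltOut (x ∷ xs)

  altIn-lookup : ∀ {xs} → AltIn xs → ∀ i → P (lookup xs i) ⇔ (toℕ i % 2 ≡ 0)
  altOut-lookup : ∀ {xs} → AltOut xs → ∀ i → P (lookup xs i) ⇔ (toℕ i % 2 ≡ 1)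
  altIn-lookup (px ∷ _) zero = mk⇔ (λ _ → refl) (λ _ → px)
  altIn-lookup (_ ∷ alt) (suc i) = ⇔.trans (altOut-lookup alt i) (⇔.sym (suc%2≡0⇔%2≡1 (toℕ i)))
  altOut-lookup (¬px ∷ _) zero = mk⇔ (⊥-elim ∘ ¬px) (λ ())
  altOut-lookup (_ ∷ alt) (suc i) = ⇔.trans (altIn-lookup alt i) (⇔.sym (suc%2≡1⇔%2≡0 (toℕ i)))

  LastOut : List A → Set _
  LastOut xs = ∀ {v} → last xs ≡ just v → ¬ P v

  lastOut-tail : ∀ x xs → LastOut (x ∷ xs) → LastOut xs
  lastOut-tail _ [] _ ()
  lastOut-tail _ (_ ∷ _) lo = lo

  independent⇒#P≤1+#¬P : ∀ xs → Independent xs →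
                         #P xs ≤ suc (#¬P xs) × (suc (#¬P xs) ≤ #P xs → AltIn xs)
  independent⇒#P≤1+#¬P [] _ = z≤n , λ ()
  independent⇒#P≤1+#¬P (x ∷ xs) ind with P? x
  ... | no _ =
    let bound , _ = independent⇒#P≤1+#¬P xs (Linked.tail ind)
    in m≤n⇒m≤1+n bound , λ excess → ⊥-elim (1+n≰n (≤-trans excess bound))
  independent⇒#P≤1+#¬P (x ∷ []) _ | yes px = s≤s z≤n , λ _ → px ∷ []
  independent⇒#P≤1+#¬P (x ∷ y ∷ xs) (x#y ∷ ind) | yes px with P? y
  ... | yes py = ⊥-elim (x#y (px , py))
  ... | no ¬py =
    let bound , alt = independent⇒#P≤1+#¬P xs (Linked.tail ind)
    in s≤s bound , λ { (s≤s excess) → px ∷ ¬py ∷ alt excess }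

  independent⇒#P≤#¬P : ∀ xs → Independent xs → LastOut xs →
                       #P xs ≤ #¬P xs × (#¬P xs ≤ #P xs → AltIn xs)
  independent⇒#P≤#¬P [] _ _ = z≤n , λ _ → []
  independent⇒#P≤#¬P (x ∷ xs) ind lo with P? x
  ... | no _ =
    let bound , _ = independent⇒#P≤#¬P xs (Linked.tail ind) (lastOut-tail x xs lo)
    in m≤n⇒m≤1+n bound , λ excess → ⊥-elim (1+n≰n (≤-trans excess bound))
  independent⇒#P≤#¬P (x ∷ []) _ lo | yes px = ⊥-elim (lo refl px)
  independent⇒#P≤#¬P (x ∷ y ∷ xs) (x#y ∷ ind) lo | yes px with P? y
  ... | yes py = ⊥-elim (x#y (px , py))
  ... | no ¬py =
    let bound , alt = independent⇒#P≤#¬P xs (Linked.tail ind)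
                        (lastOut-tail y xs (lastOut-tail x (y ∷ xs) lo))
    in s≤s bound , λ { (s≤s excess) → px ∷ ¬py ∷ alt excess }

  independent⇒altOut : ∀ x xs → ¬ P x → Independent (x ∷ xs) →
                       #¬P (x ∷ xs) ≤ #P (x ∷ xs) → AltOut (x ∷ xs)
  independent⇒altOut x xs ¬px ind with P? x
  ... | yes px = ⊥-elim (¬px px)
  ... | no _ = λ excess → ¬px ∷ proj₂ (independent⇒#P≤1+#¬P xs (Linked.tail ind)) excess

  independent⇒alternating : ∀ xs → Independent xs → #¬P xs ≤ #P xs →
                            (∀ u v → head xs ≡ just u → last xs ≡ just v → ¬ (P u × P v)) →
                            AltIn xs ⊎ AltOut xs
  independent⇒alternating [] _ _ _ = inj₁ []
  independent⇒alternating (x ∷ xs) ind balance ends = byHead (P? x)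
    where
    -- A `with` on P? x would also abstract it in the type of `balance`.
    byHead : Dec (P x) → AltIn (x ∷ xs) ⊎ AltOut (x ∷ xs)
    byHead (yes px) = inj₁ (proj₂ (independent⇒#P≤#¬P (x ∷ xs) ind lastOut) balance)
      where
      lastOut : LastOut (x ∷ xs)
      lastOut eq pv = ends x _ refl eq (px , pv)
    byHead (no ¬px) = inj₂ (independent⇒altOut x xs ¬px ind balance)

module _ {k : ℕ} where

  ones : ∀ {n} → Str (suc k) n → ℕ
  ones = count (_≟ zero)

  -- `letters` lists the symbols other than 1 in order, shifted down into Fin k; `exchange s l`
  -- puts l at the 1-positions of s and 1 elsewhere, and is only meaningful when length l ≡ ones s.
  letters : ∀ {n} → Str (suc k) n → List (Fin k)
  letters [] = []
  letters (zero ∷ s) = letters s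
  letters (suc c ∷ s) = c ∷ letters s

  exchange : ∀ {n} → Str (suc k) n → List (Fin k) → Str (suc k) n
  exchange [] _ = []
  exchange (zero ∷ s) [] = zero ∷ exchange s []
  exchange (zero ∷ s) (c ∷ l) = suc c ∷ exchange s l
  exchange (suc _ ∷ s) l = zero ∷ exchange s l

  swapOnes : ∀ {n} → Str (suc k) n → Str (suc k) n
  swapOnes s = exchange s (letters s)

  Balanced : ∀ {n} → Str (suc k) n → Set
  Balanced s = length (letters s) ≡ ones s

  length-letters+ones : ∀ {n} (s : Str (suc k) n) → length (letters s) + ones s ≡ n
  length-letters+ones [] = refl
  length-letters+ones (zero ∷ s) = trans (+-suc _ _) (cong suc (length-letters+ones s))
  length-letters+ones (suc _ ∷ s) = cong suc (length-letters+ones s)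

  letters-exchange : ∀ {n} (s : Str (suc k) n) l → length l ≡ ones s → letters (exchange s l) ≡ l
  letters-exchange [] [] _ = refl
  letters-exchange (zero ∷ s) (c ∷ l) eq = cong (c ∷_) (letters-exchange s l (suc-injective eq))
  letters-exchange (suc _ ∷ s) l eq = letters-exchange s l eq

  exchange-exchange : ∀ {n} (s : Str (suc k) n) l → length l ≡ ones s →
                      exchange (exchange s l) (letters s) ≡ s
  exchange-exchange [] [] _ = refl
  exchange-exchange (zero ∷ s) (c ∷ l) eq = cong (zero ∷_) (exchange-exchange s l (suc-injective eq))
  exchange-exchange (suc c ∷ s) l eq = cong (suc c ∷_) (exchange-exchange s l eq)

  ones-exchange : ∀ {n} (s : Str (suc k) n) l → length l ≡ ones s → ones (exchange s l) ≡ length (letters s)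
  ones-exchange [] [] _ = refl
  ones-exchange (zero ∷ s) (c ∷ l) eq = ones-exchange s l (suc-injective eq)
  ones-exchange (suc _ ∷ s) l eq = cong suc (ones-exchange s l eq)

  count-exchange : ∀ {n} (s : Str (suc k) n) l → length l ≡ ones s →
                   ∀ c → count (_≟ suc c) (exchange s l) ≡ length (filter (_≟ c) l)
  count-exchange [] [] _ _ = refl
  count-exchange (zero ∷ s) (d ∷ l) eq c with d ≟ c
  ... | yes _ = cong suc (count-exchange s l (suc-injective eq) c)
  ... | no _ = count-exchange s l (suc-injective eq) c
  count-exchange (suc _ ∷ s) l eq c = count-exchange s l eq c

  count-letters : ∀ {n} (s : Str (suc k) n) c → length (filter (_≟ c) (letters s)) ≡ count (_≟ suc c) s
  count-letters [] _ = refl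
  count-letters (zero ∷ s) c = count-letters s c
  count-letters (suc d ∷ s) c with d ≟ c
  ... | yes _ = cong suc (count-letters s c)
  ... | no _ = count-letters s c

  swapOnes-involutive : ∀ {n} (s : Str (suc k) n) → Balanced s → swapOnes (swapOnes s) ≡ s
  swapOnes-involutive s balanced = begin
    exchange (swapOnes s) (letters (swapOnes s)) ≡⟨ cong (exchange (swapOnes s)) (letters-exchange s (letters s) balanced) ⟩
    exchange (swapOnes s) (letters s)             ≡⟨ exchange-exchange s (letters s) balanced ⟩
    s                                             ∎

  count-swapOnes : ∀ {n} (s : Str (suc k) n) → Balanced s → ∀ i → count (_≟ i) (swapOnes s) ≡ count (_≟ i) s
  count-swapOnes s balanced zero = trans (ones-exchange s (letters s) balanced) balanced
  count-swapOnes s balanced (suc c) = trans (count-exchange s (letters s) balanced c) (count-letters s c)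

  swapOnes-firstIs1 : ∀ {n} (s : Str (suc k) n) → 0 < n → ¬ FirstIs1 s → FirstIs1 (swapOnes s)
  swapOnes-firstIs1 (zero ∷ _) _ ¬first = ⊥-elim (¬first refl)
  swapOnes-firstIs1 (suc _ ∷ _) _ _ = refl

firstIs1? : ∀ {k n} → Decidable (FirstIs1 {k} {n})
firstIs1? {n = zero} _ = no λ ()
firstIs1? {n = suc _} s = Vec.head s ≟ zero

firstDiffer⇒¬bothFirstIs1 : ∀ {k n} {s t : Str (suc k) n} → FirstDiffer s t → ¬ (FirstIs1 s × FirstIs1 t)
firstDiffer⇒¬bothFirstIs1 {n = suc _} differ (first-s , first-t) = differ (trans first-s (sym first-t))

swapStep⇒firstDiffer : ∀ {k n} {s t : Str k n} → SwapStep s t → FirstDiffer s t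
swapStep⇒firstDiffer {n = suc _} (zero , j≢0 , _) = ⊥-elim (j≢0 refl)
swapStep⇒firstDiffer {n = suc _} {_ ∷ _} (suc _ , _ , sj≢s0 , refl) = sj≢s0 ∘ sym

adj⇒¬bothFirstIs1 : ∀ {k n} {s t : Str (suc k) n} → Adj s t → ¬ (FirstIs1 s × FirstIs1 t)
adj⇒¬bothFirstIs1 (inj₁ step) = firstDiffer⇒¬bothFirstIs1 (swapStep⇒firstDiffer step)
adj⇒¬bothFirstIs1 (inj₂ step) = firstDiffer⇒¬bothFirstIs1 (swapStep⇒firstDiffer step) ∘ Product.swap

Δ≡0⇒total≡a₁+a₁ : ∀ {m} (a : Vec ℕ (suc (suc m))) → Δ a ≡ 0ℤ → total a ≡ Vec.head a + Vec.head a
Δ≡0⇒total≡a₁+a₁ a Δ≡0 =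
  trans (+-injective (i-j≡0⇒i≡j _ _ Δ≡0)) (cong (Vec.head a +_) (+-identityʳ (Vec.head a)))

module _ {k : ℕ} {a : Vec ℕ (suc k)} (total≡a₁+a₁ : total a ≡ Vec.lookup a zero + Vec.lookup a zero) where

  inΠ⇒balanced : ∀ s → InΠ a s → Balanced s
  inΠ⇒balanced s inΠ = trans (+-cancelʳ-≡ (ones s) (length (letters s)) a₁ (begin
    length (letters s) + ones s ≡⟨ length-letters+ones s ⟩
    total a                     ≡⟨ total≡a₁+a₁ ⟩
    a₁ + a₁                     ≡⟨ cong (a₁ +_) (inΠ zero) ⟨
    a₁ + ones s                 ∎)) (sym (inΠ zero))
    where a₁ = Vec.lookup a zero

  swapOnes-inΠ : ∀ s → InΠ a s → InΠ a (swapOnes s)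
  swapOnes-inΠ s inΠ i = trans (count-swapOnes s (inΠ⇒balanced s inΠ) i) (inΠ i)

  hamiltonPath⇒#¬firstIs1≤#firstIs1 : 0 < total a → ∀ p → IsHamiltonPath a p →
    length (filter (¬? ∘ firstIs1?) p) ≤ length (filter firstIs1? p)
  hamiltonPath⇒#¬firstIs1≤#firstIs1 0<n p (allΠ , unique , complete , _) =
    injectiveOn⇒length≤ (filter⁺ (¬? ∘ firstIs1?) {p} unique) swapOnes into injective
    where
    outside : ∀ {s} → s ∈ filter (¬? ∘ firstIs1?) p → s ∈ p × ¬ FirstIs1 s
    outside = ∈-filter⁻ (¬? ∘ firstIs1?) {xs = p}

    inΠ : ∀ {s} → s ∈ filter (¬? ∘ firstIs1?) p → InΠ a s
    inΠ = All.lookup allΠ ∘ proj₁ ∘ outside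

    into : ∀ {s} → s ∈ filter (¬? ∘ firstIs1?) p → swapOnes s ∈ filter firstIs1? p
    into {s} s∈ = ∈-filter⁺ firstIs1? (complete _ (swapOnes-inΠ s (inΠ s∈)))
                    (swapOnes-firstIs1 s 0<n (proj₂ (outside s∈)))

    injective : ∀ {s t} → s ∈ filter (¬? ∘ firstIs1?) p → t ∈ filter (¬? ∘ firstIs1?) p →
                swapOnes s ≡ swapOnes t → s ≡ t
    injective {s} {t} s∈ t∈ eq = begin
      s                     ≡⟨ swapOnes-involutive s (inΠ⇒balanced s (inΠ s∈)) ⟨
      swapOnes (swapOnes s) ≡⟨ cong swapOnes eq ⟩
      swapOnes (swapOnes t) ≡⟨ swapOnes-involutive t (inΠ⇒balanced t (inΠ t∈)) ⟩
      t                     ∎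

lemma14 : {m : ℕ} (a : Vec ℕ (suc (suc m))) → IsPartition a → Δ a ≡ 0ℤ →
          (p : List (Str (suc (suc m)) (total a))) →
          IsHamiltonPath a p → EndsDifferFirst p →
          ((i : Fin (length p)) → InΠ11 a (lookup p i) ⇔ (toℕ i % 2 ≡ 0))
          ⊎ ((i : Fin (length p)) → InΠ11 a (lookup p i) ⇔ (toℕ i % 2 ≡ 1))
lemma14 a@(a₁ ∷ _) (_ , positive) Δ≡0 p path@(allΠ , _ , _ , linked) ends =
  Sum.map (λ alt i → onPath i (altIn-lookup alt i)) (λ alt i → onPath i (altOut-lookup alt i))
    (independent⇒alternating p (Linked.map adj⇒¬bothFirstIs1 linked)
      (hamiltonPath⇒#¬firstIs1≤#firstIs1 total≡a₁+a₁ 0<total p path)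
      λ u v head≡u last≡v → firstDiffer⇒¬bothFirstIs1 (ends u v head≡u last≡v))
  where
  open Alternation firstIs1?

  total≡a₁+a₁ : total a ≡ a₁ + a₁
  total≡a₁+a₁ = Δ≡0⇒total≡a₁+a₁ a Δ≡0

  0<total : 0 < total a
  0<total = subst (0 <_) (sym total≡a₁+a₁) (≤-trans (positive zero) (m≤m+n a₁ a₁))

  onPath : ∀ {Q : Set} i → FirstIs1 (lookup p i) ⇔ Q → InΠ11 a (lookup p i) ⇔ Q
  onPath i first⇔Q = mk⇔ (Equivalence.to first⇔Q ∘ proj₂)
                         (λ q → All.lookup allΠ (∈-lookup i) , Equivalence.from first⇔Q q)
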